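{- Let $a, b, k$ be positive integers. If the player cannot win the rotating-table game with parameters $(n, m) = (a, b)$, then the player cannot win the rotating-table game with parameters $(n,m) = (ak, b)$.
   Context: The rotating-table game with parameters $(n,m)$: $n$ counters lie on the vertices (positions $1,\dots,n$, fixed from the player's perspective) of a regular $n$-gon table, each showing an element of $\mathbb{Z}_m$; the initial configuration in $\mathbb{Z}_m^n$ is arbitrary and unknown to the blindfolded player, who receives no information. Each turn the player makes a move $y \in \mathbb{Z}_m^n$, adding $y_i$ to the counter at position $i$; then the table is rotated by an arbitrary (adversarially chosen) rotation, i.e. the counters are cyclically shifted by any amount (possibly zero). A strategy is a fixed finite sequence of moves. The player "can win" if some finite sequence of moves guarantees that, for every initial configuration and every choice of rotations, at some point (initially or after some move) all counters simultaneously show $0$. -}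

module Defs where

open import Data.Nat using (ℕ; zero; suc; _+_; _*_; NonZero)
open import Data.Nat.DivMod using (_mod_)
open import Data.Fin using (Fin; toℕ)
open import Data.List using (List; []; _∷_; length)
open import Data.Product using (Σ; ∃; _×_; _,_)
open import Relation.Binary.PropositionalEquality using (_≡_)

_+[_]_ : ∀ {m} → Fin m → (m : ℕ) → .{{NonZero m}} → Fin m → Fin m
_+[_]_ x m y = (toℕ x + toℕ y) mod m

-- A configuration: the value of the counter at each position 1..n (as Fin n).
Config : ℕ → ℕ → Set
Config n m = Fin n → Fin m

Move : ℕ → ℕ → Set
Move = Config

applyMove : ∀ {n m} .{{_ : NonZero m}} → Config n m → Move n m → Config n m
applyMove {m = m} c y i = c i +[ m ] y i

rotate : ∀ {n m} .{{_ : NonZero n}} → ℕ → Config n m → Config n m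
rotate {n} r c i = c ((toℕ i + r) mod n)

IsZero : ∀ {n m} → Config n m → Set
IsZero c = ∀ i → toℕ (c i) ≡ 0

-- Configurations occurring during play: element 0 is the initial configuration,
-- element j+1 is the configuration after the (j+1)-th move and the subsequent
-- (adversarial) rotation.  The rotation after move j is rots j.
-- `Reaches c ys rots` : at some point (initially or after some move) all
-- counters show 0.
data Reaches {n m : ℕ} .{{_ : NonZero n}} .{{_ : NonZero m}}
     : Config n m → List (Move n m) → (ℕ → ℕ) → Set where
  here  : ∀ {c ys rots} → IsZero {n} {m} c → Reaches c ys rots
  there : ∀ {c y ys rots} →
          Reaches (rotate {n} {m} (rots 0) (applyMove {n} {m} c y)) ys (λ j → rots (suc j)) →
          Reaches c (y ∷ ys) rots

Winning : (n m : ℕ) .{{_ : NonZero n}} .{{_ : NonZero m}} → List (Move n m) → Set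
Winning n m ys = ∀ (c : Config n m) (rots : ℕ → ℕ) → Reaches c ys rots

CanWin : (n m : ℕ) .{{_ : NonZero n}} .{{_ : NonZero m}} → Set
CanWin n m = Σ (List (Move n m)) (Winning n m)

-- Fold a configuration on A * K positions onto A positions by summing, for each
-- residue x mod A, the K counters at positions x, x + A, ..., x + (K - 1) A.
-- Folding is additive and sends zero to zero, and since A divides A * K it turns a
-- rotation by r of the big table into the rotation by r of the folded one. So folding
-- each move of a winning strategy for A * K counters wins for A counters: play the big
-- strategy against the zero-extension of the small configuration (which folds back to
-- it) under the same rotations; when the big table shows all zeros, so does the small one.
module Submission where

open import Defs
open import Data.Nat using (ℕ; zero; suc; _+_; _*_; _<_; _≤_; z<s; s<s; s≤s; NonZero; _<?_)
open import Data.Nat.Properties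
open import Data.Nat.DivMod
open import Data.Nat.Tactic.RingSolver using (solve-∀)
open import Data.Fin using (Fin; toℕ; fromℕ<) renaming (zero to fzero)
open import Data.Fin.Properties using (toℕ-fromℕ<; fromℕ<-cong; fromℕ<-toℕ; toℕ-injective; toℕ<n)
open import Data.List using (map)
open import Data.Product using (_,_)
open import Function using (_∘_)
open import Relation.Nullary using (¬_; yes; no; contradiction)
open import Relation.Binary.PropositionalEquality
open import Algebra.Properties.CommutativeSemigroup +-commutativeSemigroup using (interchange)

∑< : ℕ → (ℕ → ℕ) → ℕ
∑< zero    f = 0
∑< (suc n) f = f 0 + ∑< n (f ∘ suc)

syntax ∑< n (λ j → e) = ∑[ j < n ] e

∑-cong : ∀ n {f g : ℕ → ℕ} → (∀ j → j < n → f j ≡ g j) → ∑< n f ≡ ∑< n g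
∑-cong zero    eq = refl
∑-cong (suc n) eq = cong₂ _+_ (eq 0 z<s) (∑-cong n (λ j j<n → eq (suc j) (s<s j<n)))

∑-zero : ∀ n {f : ℕ → ℕ} → (∀ j → j < n → f j ≡ 0) → ∑< n f ≡ 0
∑-zero zero    eq = refl
∑-zero (suc n) eq = cong₂ _+_ (eq 0 z<s) (∑-zero n (λ j j<n → eq (suc j) (s<s j<n)))

∑-distrib-+ : ∀ n (f g : ℕ → ℕ) → ∑[ j < n ] (f j + g j) ≡ ∑< n f + ∑< n g
∑-distrib-+ zero    f g = refl
∑-distrib-+ (suc n) f g =
  trans (cong (f 0 + g 0 +_) (∑-distrib-+ n (f ∘ suc) (g ∘ suc))) (interchange (f 0) (g 0) _ _)

∑-last : ∀ n f → ∑< (suc n) f ≡ ∑< n f + f n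
∑-last zero    f = +-comm (f 0) 0
∑-last (suc n) f = trans (cong (f 0 +_) (∑-last n (f ∘ suc))) (sym (+-assoc (f 0) _ _))

∑-shift : ∀ n f → f n ≡ f 0 → ∑< n (f ∘ suc) ≡ ∑< n f
∑-shift zero    f _     = refl
∑-shift (suc n) f fn≡f0 = begin
  ∑< (suc n) (f ∘ suc)        ≡⟨ ∑-last n (f ∘ suc) ⟩
  ∑< n (f ∘ suc) + f (suc n)  ≡⟨ cong (∑< n (f ∘ suc) +_) fn≡f0 ⟩
  ∑< n (f ∘ suc) + f 0        ≡⟨ +-comm _ (f 0) ⟩
  ∑< (suc n) f                ∎
  where open ≡-Reasoning

Periodic : ℕ → (ℕ → ℕ) → Set
Periodic n f = ∀ j → f (j + n) ≡ f j

∑-rotate : ∀ n q f → Periodic n f → ∑[ j < n ] f (q + j) ≡ ∑< n f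
∑-rotate n zero    f per = refl
∑-rotate n (suc q) f per = trans (∑-rotate n q (f ∘ suc) (per ∘ suc)) (∑-shift n f (per 0))

module _ (d : ℕ) .{{_ : NonZero d}} where

  toℕ-mod : ∀ p → toℕ (p mod d) ≡ p % d
  toℕ-mod p = toℕ-fromℕ< (m%n<n p d)

  mod-cong : ∀ p q → p % d ≡ q % d → p mod d ≡ q mod d
  mod-cong p q eq = fromℕ<-cong _ _ eq (m%n<n p d) (m%n<n q d)

  [m%d+n]%d≡[m+n]%d : ∀ m n → (m % d + n) % d ≡ (m + n) % d
  [m%d+n]%d≡[m+n]%d m n = begin
    (m % d + n) % d          ≡⟨ %-distribˡ-+ (m % d) n d ⟩
    (m % d % d + n % d) % d  ≡⟨ cong (λ x → (x + n % d) % d) (m%n%n≡m%n m d) ⟩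
    (m % d + n % d) % d      ≡⟨ %-distribˡ-+ m n d ⟨
    (m + n) % d              ∎
    where open ≡-Reasoning

  [m+n%d]%d≡[m+n]%d : ∀ m n → (m + n % d) % d ≡ (m + n) % d
  [m+n%d]%d≡[m+n]%d m n = begin
    (m + n % d) % d  ≡⟨ cong (_% d) (+-comm m (n % d)) ⟩
    (n % d + m) % d  ≡⟨ [m%d+n]%d≡[m+n]%d n m ⟩
    (n + m) % d      ≡⟨ cong (_% d) (+-comm n m) ⟩
    (m + n) % d      ∎
    where open ≡-Reasoning

  ∑-% : ∀ n f → ∑[ j < n ] (f j % d) % d ≡ ∑< n f % d
  ∑-% zero    f = refl
  ∑-% (suc n) f = begin
    (f 0 % d + ∑[ j < n ] (f (suc j) % d)) % d      ≡⟨ [m%d+n]%d≡[m+n]%d (f 0) _ ⟩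
    (f 0 + ∑[ j < n ] (f (suc j) % d)) % d          ≡⟨ [m+n%d]%d≡[m+n]%d (f 0) _ ⟨
    (f 0 + ∑[ j < n ] (f (suc j) % d) % d) % d      ≡⟨ cong (λ x → (f 0 + x) % d) (∑-% n (f ∘ suc)) ⟩
    (f 0 + ∑< n (f ∘ suc) % d) % d                  ≡⟨ [m+n%d]%d≡[m+n]%d (f 0) _ ⟩
    (f 0 + ∑< n (f ∘ suc)) % d                      ∎
    where open ≡-Reasoning

module _ {n m : ℕ} .{{_ : NonZero n}} .{{_ : NonZero m}} where

  at : Config n m → ℕ → ℕ
  at c p = toℕ (c (p mod n))

  at-periodic : ∀ c → Periodic n (at c)
  at-periodic c p = cong (toℕ ∘ c) (mod-cong n (p + n) p ([m+n]%n≡m%n p n))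

  at-rotate : ∀ r c p → at (rotate r c) p ≡ at c (p + r)
  at-rotate r c p = cong (toℕ ∘ c) (mod-cong n (toℕ (p mod n) + r) (p + r) (begin
    (toℕ (p mod n) + r) % n  ≡⟨ cong (λ x → (x + r) % n) (toℕ-mod n p) ⟩
    (p % n + r) % n          ≡⟨ [m%d+n]%d≡[m+n]%d n p r ⟩
    (p + r) % n              ∎))
    where open ≡-Reasoning

  at-applyMove : ∀ c y p → at (applyMove c y) p ≡ (at c p + at y p) % m
  at-applyMove c y p = toℕ-mod m _

  Reaches-resp-≗ : ∀ {c d : Config n m} {ys rots} → c ≗ d → Reaches c ys rots → Reaches d ys rots
  Reaches-resp-≗ c≗d (here z)  = here (λ i → trans (cong toℕ (sym (c≗d i))) (z i))
  Reaches-resp-≗ c≗d (there r) = there (Reaches-resp-≗ (λ i → cong (λ v → v +[ m ] _) (c≗d _)) r)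

module Fold (a k b : ℕ) where

  A K N M : ℕ
  A = suc a
  K = suc k
  N = A * K
  M = suc b

  blockSum : Config N M → ℕ → ℕ
  blockSum C i = ∑[ j < K ] at C (i + j * A)

  fold : Config N M → Config A M
  fold C x = blockSum C (toℕ x) mod M

  -- With i + r = s + q A, rotating by r only cycles the K summands of the block of s by q.
  blockSum-rotate : ∀ r C i → blockSum (rotate r C) i ≡ blockSum C ((i + r) % A)
  blockSum-rotate r C i = begin
    ∑[ j < K ] at (rotate r C) (i + j * A)  ≡⟨ ∑-cong K (λ j _ → at-rotate r C (i + j * A)) ⟩
    ∑[ j < K ] at C (i + j * A + r)         ≡⟨ ∑-cong K (λ j _ → cong (at C) (regroup j)) ⟩
    ∑[ j < K ] g (q + j)                    ≡⟨ ∑-rotate K q g g-periodic ⟩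
    ∑[ j < K ] g j                          ∎
    where
    open ≡-Reasoning
    s q : ℕ
    s = (i + r) % A
    q = (i + r) / A
    g : ℕ → ℕ
    g t = at C (s + t * A)
    regroup : ∀ j → i + j * A + r ≡ s + (q + j) * A
    regroup j = begin
      i + j * A + r      ≡⟨ pull-r i j A r ⟩
      (i + r) + j * A    ≡⟨ cong (_+ j * A) (m≡m%n+[m/n]*n (i + r) A) ⟩
      s + q * A + j * A  ≡⟨ factor-A s q j A ⟩
      s + (q + j) * A    ∎
      where
      pull-r : ∀ i j A r → i + j * A + r ≡ (i + r) + j * A
      pull-r = solve-∀
      factor-A : ∀ s q j A → s + q * A + j * A ≡ s + (q + j) * A
      factor-A = solve-∀
    g-periodic : Periodic K g
    g-periodic t = begin
      at C (s + (t + K) * A)  ≡⟨ cong (at C) (add-period s t) ⟩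
      at C (s + t * A + N)    ≡⟨ at-periodic C (s + t * A) ⟩
      at C (s + t * A)        ∎
      where
      add-period : ∀ s t → s + (t + K) * A ≡ s + t * A + A * K
      add-period = solve-∀

  blockSum-applyMove : ∀ C Y i → blockSum (applyMove C Y) i % M ≡ (blockSum C i + blockSum Y i) % M
  blockSum-applyMove C Y i = begin
    ∑[ j < K ] at (applyMove C Y) (p j) % M         ≡⟨ cong (_% M) (∑-cong K (λ j _ → at-applyMove C Y (p j))) ⟩
    ∑[ j < K ] ((at C (p j) + at Y (p j)) % M) % M  ≡⟨ ∑-% M K (λ j → at C (p j) + at Y (p j)) ⟩
    ∑[ j < K ] (at C (p j) + at Y (p j)) % M        ≡⟨ cong (_% M) (∑-distrib-+ K (at C ∘ p) (at Y ∘ p)) ⟩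
    (blockSum C i + blockSum Y i) % M               ∎
    where
    open ≡-Reasoning
    p : ℕ → ℕ
    p j = i + j * A

  fold-applyMove : ∀ C Y → fold (applyMove C Y) ≗ applyMove (fold C) (fold Y)
  fold-applyMove C Y x = mod-cong M (blockSum (applyMove C Y) i) (toℕ (fold C x) + toℕ (fold Y x)) sums
    where
    open ≡-Reasoning
    i : ℕ
    i = toℕ x
    sums : blockSum (applyMove C Y) i % M ≡ (toℕ (fold C x) + toℕ (fold Y x)) % M
    sums = begin
      blockSum (applyMove C Y) i % M             ≡⟨ blockSum-applyMove C Y i ⟩
      (blockSum C i + blockSum Y i) % M          ≡⟨ %-distribˡ-+ (blockSum C i) (blockSum Y i) M ⟩
      (blockSum C i % M + blockSum Y i % M) % M  ≡⟨ cong₂ (λ u v → (u + v) % M)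
                                                        (toℕ-mod M (blockSum C i)) (toℕ-mod M (blockSum Y i)) ⟨
      (toℕ (fold C x) + toℕ (fold Y x)) % M      ∎

  fold-rotate : ∀ r C → fold (rotate r C) ≗ rotate r (fold C)
  fold-rotate r C x =
    cong (_mod M) (trans (blockSum-rotate r C (toℕ x)) (cong (blockSum C) (sym (toℕ-mod A (toℕ x + r)))))

  fold-zero : ∀ {C} → IsZero C → IsZero (fold C)
  fold-zero {C} C≡0 x = begin
    toℕ (blockSum C (toℕ x) mod M)  ≡⟨ toℕ-mod M (blockSum C (toℕ x)) ⟩
    blockSum C (toℕ x) % M          ≡⟨ cong (_% M) (∑-zero K (λ j _ → C≡0 ((toℕ x + j * A) mod N))) ⟩
    0                               ∎
    where open ≡-Reasoning

  Reaches-fold : ∀ {C : Config N M} {Ys rots} → Reaches C Ys rots → Reaches (fold C) (map fold Ys) rots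
  Reaches-fold (here C≡0) = here (fold-zero C≡0)
  Reaches-fold {C} {rots = rots} (there {y = Y} reach) =
    there (Reaches-resp-≗ fold-step (Reaches-fold reach))
    where
    fold-step : fold (rotate (rots 0) (applyMove C Y)) ≗ rotate (rots 0) (applyMove (fold C) (fold Y))
    fold-step x = trans (fold-rotate (rots 0) (applyMove C Y) x) (fold-applyMove C Y ((toℕ x + rots 0) mod A))

  padZero : Config A M → ℕ → Fin M
  padZero c q with q <? A
  ... | yes q<A = c (fromℕ< q<A)
  ... | no  _   = fzero

  padZero-< : ∀ c q (q<A : q < A) → padZero c q ≡ c (fromℕ< q<A)
  padZero-< c q q<A with q <? A
  ... | yes _   = refl
  ... | no  q≮A = contradiction q<A q≮A

  padZero-≥ : ∀ c q → A ≤ q → padZero c q ≡ fzero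
  padZero-≥ c q A≤q with q <? A
  ... | yes q<A = contradiction q<A (≤⇒≯ A≤q)
  ... | no  _   = refl

  extendByZero : Config A M → Config N M
  extendByZero c = padZero c ∘ toℕ

  at-extendByZero : ∀ c p → p < N → at (extendByZero c) p ≡ toℕ (padZero c p)
  at-extendByZero c p p<N = cong (toℕ ∘ padZero c) (trans (toℕ-mod N p) (m<n⇒m%n≡m p<N))

  i+[1+j]A<N : ∀ {i j} → i < A → j < k → i + suc j * A < N
  i+[1+j]A<N {i} {j} i<A j<k = begin-strict
    i + suc j * A    <⟨ +-monoˡ-< (suc j * A) i<A ⟩
    suc (suc j) * A  ≤⟨ *-monoˡ-≤ A (s≤s j<k) ⟩
    K * A            ≡⟨ *-comm K A ⟩
    N                ∎
    where open ≤-Reasoning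

  blockSum-extendByZero : ∀ c x → blockSum (extendByZero c) (toℕ x) ≡ toℕ (c x)
  blockSum-extendByZero c x = begin
    at (extendByZero c) (i + 0) + ∑[ j < k ] at (extendByZero c) (i + suc j * A)
      ≡⟨ cong₂ _+_ (cong (at (extendByZero c)) (+-identityʳ i)) (∑-zero k outside) ⟩
    at (extendByZero c) i + 0
      ≡⟨ +-identityʳ _ ⟩
    at (extendByZero c) i
      ≡⟨ at-extendByZero c i (<-≤-trans i<A (m≤m*n A K)) ⟩
    toℕ (padZero c i)
      ≡⟨ cong toℕ (trans (padZero-< c i i<A) (cong c (fromℕ<-toℕ x i<A))) ⟩
    toℕ (c x) ∎
    where
    open ≡-Reasoning
    i : ℕ
    i = toℕ x
    i<A : i < A
    i<A = toℕ<n x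
    outside : ∀ j → j < k → at (extendByZero c) (i + suc j * A) ≡ 0
    outside j j<k = begin
      at (extendByZero c) (i + suc j * A)  ≡⟨ at-extendByZero c _ (i+[1+j]A<N i<A j<k) ⟩
      toℕ (padZero c (i + suc j * A))      ≡⟨ cong toℕ (padZero-≥ c _ (≤-trans (m≤m+n A (j * A)) (m≤n+m _ i))) ⟩
      0                                    ∎

  fold-extendByZero : ∀ c → fold (extendByZero c) ≗ c
  fold-extendByZero c x = toℕ-injective (begin
    toℕ (fold (extendByZero c) x)           ≡⟨ toℕ-mod M (blockSum (extendByZero c) (toℕ x)) ⟩
    blockSum (extendByZero c) (toℕ x) % M   ≡⟨ cong (_% M) (blockSum-extendByZero c x) ⟩
    toℕ (c x) % M                           ≡⟨ m<n⇒m%n≡m (toℕ<n (c x)) ⟩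
    toℕ (c x)                               ∎)
    where open ≡-Reasoning

  canWin-fold : CanWin N M → CanWin A M
  canWin-fold (Ys , win) =
    map fold Ys , λ c rots → Reaches-resp-≗ (fold-extendByZero c) (Reaches-fold (win (extendByZero c) rots))

lemma3p1 : ∀ (a b k : ℕ) →
    ¬ CanWin (suc a) (suc b) → ¬ CanWin (suc a * suc k) (suc b)
lemma3p1 a b k cannotWin = cannotWin ∘ canWin-fold
  where open Fold a k b
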